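{- Let $b\ge 2$ and $m\ge 0$ be integers. If the box-selection procedure described in the context, in dimension $2$ with base $b$ and resolution $m$, terminates after exactly $b^m$ steps, then its output $X_1,\dots,X_{b^m}$ constitutes a $(0,m,2)$-net in base $b$, i.e. every elementary $b$-adic interval in $[0,1)^2$ of area $b^{ -m}$ contains exactly one of $X_1,\dots,X_{b^m}$.
   Context: An elementary $b$-adic interval in $[0,1)^s$ is a set $\prod_{j=1}^s\left[\frac{a_j}{b^{d_j}},\frac{a_j+1}{b^{d_j}}\right)$ with $d_j\in\mathbb{N}_0$ and $a_j\in\{0,1,\dots,b^{d_j}-1\}$. A grid box of resolution $m$ is a set $X=\prod_{j=1}^s\left[\frac{u_j}{b^m},\frac{u_j+1}{b^m}\right)$ with $u_j\in\{0,\dots,b^m-1\}$. For such $X$, $\mathcal{E}_m(X)$ denotes the set of all elementary $b$-adic intervals of volume $b^{ -m}$ containing $X$. The procedure (dimension $s$, here $s=2$): set $\mathcal{U}_1=[0,1)^s$ and $n=1$. While $\mathcal{U}_n\neq\emptyset$: choose an arbitrary grid box $X_n$ of resolution $m$ with $X_n\subseteq\mathcal{U}_n$, set $\mathcal{U}_{n+1}=\mathcal{U}_n\setminus\bigcup_{E\in\mathcal{E}_m(X_n)}E$, and increase $n$ by one. The output is the list of chosen boxes; the number of steps is the number of boxes chosen. -}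

module Defs where

open import Data.Nat using (ℕ; suc; _+_; _*_; _^_; _≤_; _<_)
open import Data.Fin using (Fin; toℕ)
open import Data.Product using (Σ; _×_)
open import Relation.Binary.PropositionalEquality using (_≡_)
open import Relation.Nullary using (¬_)

-- A grid box of resolution m in base b:
--   [u₁/b^m,(u₁+1)/b^m) × [u₂/b^m,(u₂+1)/b^m),  u_j ∈ {0,…,b^m-1}.
record GridBox (b m : ℕ) : Set where
  constructor box
  field
    u₁ u₂ : Fin (b ^ m)

-- An elementary b-adic interval in [0,1)^2:
--   [a₁/b^d₁,(a₁+1)/b^d₁) × [a₂/b^d₂,(a₂+1)/b^d₂),  a_j ∈ {0,…,b^d_j-1}.
record ElemInterval (b : ℕ) : Set where
  constructor elem
  field
    d₁ d₂ : ℕ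
    a₁ : Fin (b ^ d₁)
    a₂ : Fin (b ^ d₂)

open ElemInterval public

-- Volume of E equals b^{-m}, i.e. b^{-(d₁+d₂)} = b^{-m}, i.e. d₁ + d₂ = m (b ≥ 2).
HasVolume : ∀ {b} → ElemInterval b → ℕ → Set
HasVolume E m = d₁ E + d₂ E ≡ m

-- One-dimensional containment of real intervals
--   [u/b^m,(u+1)/b^m) ⊆ [a/b^d,(a+1)/b^d)
-- i.e.  a/b^d ≤ u/b^m  and  (u+1)/b^m ≤ (a+1)/b^d, cross-multiplied.
IntervalIn : (b m u d a : ℕ) → Set
IntervalIn b m u d a = (a * b ^ m ≤ u * b ^ d) × (suc u * b ^ d ≤ suc a * b ^ m)

BoxIn : ∀ b m → GridBox b m → ElemInterval b → Set
BoxIn b m (box u₁ u₂) E =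
  IntervalIn b m (toℕ u₁) (d₁ E) (toℕ (a₁ E)) × IntervalIn b m (toℕ u₂) (d₂ E) (toℕ (a₂ E))

-- Y ⊆ ⋃_{E ∈ 𝓔_m(X)} E  : Y lies in some elementary interval of volume b^{-m}
-- containing X.  (Since all these sets are unions of resolution-m grid boxes, a
-- grid box meets such an E iff it is contained in it.)
CoveredBy : ∀ b m → GridBox b m → GridBox b m → Set
CoveredBy b m X Y = Σ (ElemInterval b) λ E → HasVolume E m × BoxIn b m X E × BoxIn b m Y E

record ValidRun (b m N : ℕ) (X : Fin N → GridBox b m) : Set where
  field
    -- X_n ⊆ 𝓤_n : X_n is disjoint from (equivalently not contained in)
    -- every E ∈ 𝓔_m(X_k) for k < n.
    choice : ∀ (n k : Fin N) → toℕ k < toℕ n → ¬ CoveredBy b m (X k) (X n)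
    -- 𝓤_{N+1} = ∅ : every grid box (hence every point of [0,1)^2) is removed.
    terminates : ∀ (Y : GridBox b m) → Σ (Fin N) λ k → CoveredBy b m (X k) Y

ContainsExactlyOne : ∀ b m N → (Fin N → GridBox b m) → ElemInterval b → Set
ContainsExactlyOne b m N X E =
  Σ (Fin N) λ i → BoxIn b m (X i) E × (∀ (j : Fin N) → BoxIn b m (X j) E → j ≡ i)

module Submission where

-- Fix the shape (d₁, d₂) of the interval, d₁ + d₂ = m.  In one dimension a
-- grid cell [u/b^m, (u+1)/b^m) lies in the b-adic interval of length b^-d
-- with index u / b^(m-d) (module Ancestor).  Hence every grid box lies in an
-- elementary interval of shape (d₁, d₂) computed coordinatewise, its "cell"
-- (module Cells).  The choice rule of the procedure forbids two chosen
-- boxes from sharing an elementary interval of area b^-m (chosen-separated),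
-- so sending the i-th chosen box to its cell is injective.  There are b^m
-- chosen boxes and b^d₁ · b^d₂ = b^m cells, and an injection between finite
-- sets of equal size is surjective (injective⇒surjective).  So every cell
-- contains a chosen box (existence), and separation gives uniqueness.

open import Defs
open import Data.Nat
  using (ℕ; suc; _+_; _*_; _^_; _≤_; _<_; NonZero; >-nonZero; s≤s; z≤n)
open import Data.Nat.Properties
  using (≤-trans; ≤-reflexive; *-comm; *-assoc; *-monoˡ-≤; +-monoˡ-≤;
         m^n≢0; ^-distribˡ-+-*)
open import Data.Nat.DivMod
  using (_/_; m/n*n≤m; m<n*o⇒m/o<n; m≡m%n+[m/n]*n; m%n<n)
open import Data.Fin using (Fin; toℕ; fromℕ<; combine; punchOut; _≟_)
open import Data.Fin.Properties
  using (toℕ-fromℕ<; toℕ<n; combine-injective; pigeonhole; punchOut-injective;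
         any?; <-cmp)
  renaming (<-irrefl to <-irreflᶠ)
open import Data.Product using (_×_; _,_; ∃; uncurry)
open import Data.Product.Properties using (×-≡,≡→≡)
open import Data.Empty using (⊥-elim)
open import Function using (_∘_)
open import Function.Definitions using (Injective)
open import Relation.Binary.Definitions using (tri<; tri≈; tri>)
open import Relation.Binary.PropositionalEquality
  using (_≡_; _≢_; refl; sym; trans; cong; subst; module ≡-Reasoning)
open import Relation.Nullary using (¬_; yes; no)

-- With b^m = b^d · Q (so Q = b^(m-d)), the grid
-- cell of index u at resolution m lies in the b-adic interval of length b^-d
-- with index u / Q, and that index is in range.
module Ancestor (b m d Q : ℕ) .{{_ : NonZero Q}}
                (split : b ^ m ≡ b ^ d * Q) where

  rescale : ∀ a → a * b ^ m ≡ a * Q * b ^ d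
  rescale a = begin
    a * b ^ m        ≡⟨ cong (a *_) split ⟩
    a * (b ^ d * Q)  ≡⟨ cong (a *_) (*-comm (b ^ d) Q) ⟩
    a * (Q * b ^ d)  ≡⟨ sym (*-assoc a Q (b ^ d)) ⟩
    a * Q * b ^ d    ∎
    where open ≡-Reasoning

  ancestor-contains : ∀ u → IntervalIn b m u d (u / Q)
  ancestor-contains u =
      subst (_≤ u * b ^ d) (sym (rescale (u / Q))) (*-monoˡ-≤ (b ^ d) (m/n*n≤m u Q))
    , subst (suc u * b ^ d ≤_) (sym (rescale (suc (u / Q)))) (*-monoˡ-≤ (b ^ d) u<[1+u/Q]Q)
    where
    u<[1+u/Q]Q : suc u ≤ suc (u / Q) * Q
    u<[1+u/Q]Q = subst (λ v → suc v ≤ suc (u / Q) * Q) (sym (m≡m%n+[m/n]*n u Q))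
                   (+-monoˡ-≤ ((u / Q) * Q) (m%n<n u Q))

  ancestor-bound : ∀ {u} → u < b ^ m → u / Q < b ^ d
  ancestor-bound u<b^m = m<n*o⇒m/o<n (subst (_ <_) split u<b^m)

-- Pigeonhole: an injection into Fin (1 + k) that misses some t would, after
-- punching t out of the codomain, be an injection Fin n → Fin k with k < n.
injection-misses-nothing : ∀ {n k} (f : Fin n → Fin (suc k)) → k < n →
                           Injective _≡_ _≡_ f → ∀ t → ¬ (∀ i → t ≢ f i)
injection-misses-nothing f k<n f-injective t avoids
  with pigeonhole k<n (λ i → punchOut (avoids i))
... | i , j , i<j , same =
  <-irreflᶠ (f-injective (punchOut-injective (avoids i) (avoids j) same)) i<j

injective⇒surjective : ∀ {n k} (f : Fin n → Fin k) → k ≤ n →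
                       Injective _≡_ _≡_ f → ∀ t → ∃ λ i → f i ≡ t
injective⇒surjective {k = suc k} f 1+k≤n f-injective t with any? (λ i → f i ≟ t)
... | yes hit  = hit
... | no ¬hit = ⊥-elim (injection-misses-nothing f 1+k≤n f-injective t
                          (λ i t≡fi → ¬hit (i , sym t≡fi)))

chosen-separated : ∀ {b m N X} → ValidRun b m N X →
                   ∀ E → HasVolume E m → ∀ {i j} →
                   BoxIn b m (X i) E → BoxIn b m (X j) E → i ≡ j
chosen-separated run E vol {i} {j} Xi∈E Xj∈E with <-cmp i j
... | tri< i<j _ _ = ⊥-elim (ValidRun.choice run j i i<j (E , vol , Xi∈E , Xj∈E))
... | tri≈ _ i≡j _ = i≡j
... | tri> _ _ j<i = ⊥-elim (ValidRun.choice run i j j<i (E , vol , Xj∈E , Xi∈E))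

module Cells (b d₁ d₂ : ℕ) .{{_ : NonZero b}} where

  private
    instance
      b^d₁≢0 : NonZero (b ^ d₁)
      b^d₁≢0 = m^n≢0 b d₁
      b^d₂≢0 : NonZero (b ^ d₂)
      b^d₂≢0 = m^n≢0 b d₂

    module Ancestor₁ = Ancestor b (d₁ + d₂) d₁ (b ^ d₂) (^-distribˡ-+-* b d₁ d₂)
    module Ancestor₂ = Ancestor b (d₁ + d₂) d₂ (b ^ d₁)
                         (trans (^-distribˡ-+-* b d₁ d₂) (*-comm (b ^ d₁) (b ^ d₂)))

  Cell : Set
  Cell = Fin (b ^ d₁) × Fin (b ^ d₂)

  interval : Cell → ElemInterval b
  interval (a₁ , a₂) = elem d₁ d₂ a₁ a₂

  index : Cell → Fin (b ^ d₁ * b ^ d₂)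
  index = uncurry combine

  index-injective : Injective _≡_ _≡_ index
  index-injective {a₁ , a₂} {c₁ , c₂} same = ×-≡,≡→≡ (combine-injective a₁ a₂ c₁ c₂ same)

  cell : GridBox b (d₁ + d₂) → Cell
  cell (box u₁ u₂) = fromℕ< (Ancestor₁.ancestor-bound (toℕ<n u₁))
                   , fromℕ< (Ancestor₂.ancestor-bound (toℕ<n u₂))

  box-in-cell : ∀ X → BoxIn b (d₁ + d₂) X (interval (cell X))
  box-in-cell (box u₁ u₂) =
      subst (IntervalIn b (d₁ + d₂) (toℕ u₁) d₁)
        (sym (toℕ-fromℕ< (Ancestor₁.ancestor-bound (toℕ<n u₁))))
        (Ancestor₁.ancestor-contains (toℕ u₁))
    , subst (IntervalIn b (d₁ + d₂) (toℕ u₂) d₂)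
        (sym (toℕ-fromℕ< (Ancestor₂.ancestor-bound (toℕ<n u₂))))
        (Ancestor₂.ancestor-contains (toℕ u₂))

every-cell-hit : ∀ b d₁ d₂ .{{_ : NonZero b}} →
                 (X : Fin (b ^ (d₁ + d₂)) → GridBox b (d₁ + d₂)) →
                 ValidRun b (d₁ + d₂) (b ^ (d₁ + d₂)) X →
                 ∀ c → ∃ λ i → Cells.cell b d₁ d₂ (X i) ≡ c
every-cell-hit b d₁ d₂ X run c =
  let (i , same-index) = injective⇒surjective (index ∘ cell ∘ X) cells≤boxes
                                              chosen-cell-injective (index c)
  in  i , index-injective same-index
  where
  open Cells b d₁ d₂
  cells≤boxes : b ^ d₁ * b ^ d₂ ≤ b ^ (d₁ + d₂)
  cells≤boxes = ≤-reflexive (sym (^-distribˡ-+-* b d₁ d₂))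
  chosen-cell-injective : Injective _≡_ _≡_ (index ∘ cell ∘ X)
  chosen-cell-injective {i} {j} same =
    chosen-separated run (interval (cell (X i))) refl (box-in-cell (X i))
      (subst (BoxIn b (d₁ + d₂) (X j) ∘ interval) (sym (index-injective same))
        (box-in-cell (X j)))

lemma2 : (b m : ℕ) → 2 ≤ b → (X : Fin (b ^ m) → GridBox b m) → ValidRun b m (b ^ m) X → (E : ElemInterval b) → HasVolume E m → ContainsExactlyOne b m (b ^ m) X E
lemma2 b .(d₁ + d₂) 2≤b X run (elem d₁ d₂ a₁ a₂) refl =
  let (i , cell≡a) = every-cell-hit b d₁ d₂ X run (a₁ , a₂)
      Xi∈E = subst (BoxIn b (d₁ + d₂) (X i) ∘ interval) cell≡a (box-in-cell (X i))
  in  i , Xi∈E , λ j Xj∈E → chosen-separated run (elem d₁ d₂ a₁ a₂) refl Xj∈E Xi∈E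
  where
  instance
    b≢0 : NonZero b
    b≢0 = >-nonZero (≤-trans (s≤s z≤n) 2≤b)
  open Cells b d₁ d₂
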